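{- Let $p$ be a prime. The function $k\mapsto \widetilde p(k)$ is monotone non-decreasing on the non-negative integers, and for every integer $r\ge2$, \[ \widetilde p(p^r)\ge \frac{p^{r(r-1)/2}}{(r-1)^{r-1}}. \]
   Context: $\widetilde p(j)$ denotes the number of partitions of the integer $j\ge0$ into parts that are powers of $p$ (including $p^0=1$), with $\widetilde p(0)=1$. -}

module Defs where

open import Data.Nat using (ℕ; zero; suc; _+_; _*_; _∸_; _^_; _≤ᵇ_)
open import Data.Bool using (if_then_else_)

sumUpTo : ℕ → (ℕ → ℕ) → ℕ
sumUpTo zero    f = f 0
sumUpTo (suc n) f = sumUpTo n f + f (suc n)

-- partBounded p m j = number of partitions of j into parts from
-- {p^0, p^1, ..., p^m}  (multiplicity k of the part p^m ranges over k * p^m ≤ j).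
partBounded : ℕ → ℕ → ℕ → ℕ
partBounded p zero    j = 1
partBounded p (suc m) j =
  sumUpTo j (λ k → if k * p ^ suc m ≤ᵇ j
                     then partBounded p m (j ∸ k * p ^ suc m)
                     else 0)

-- p̃(j): number of partitions of j into powers of p.  For p ≥ 2 every part
-- p^e of a partition of j satisfies e < j (as p^e ≥ 2^e > e), so allowing
-- exponents 0..j covers all partitions (for j = 0 this gives 1).
pTilde : ℕ → ℕ → ℕ
pTilde p j = partBounded p j j

-- Let A_m(j) count partitions of j into the parts 1, p, …, p^m.  Splitting off
-- one copy of q = p^(m+1) gives A_(m+1)(j) ≥ A_m(j) + A_(m+1)(j − q),
-- and together with (y + q)^(m+1) ≤ y^(m+1) + (m+1) q (y + q)^m this lifts a
-- bound j^m ≤ C·A_m(j) to j^(m+1) ≤ (m+1) q C·A_(m+1)(j).  Iterating from m = 0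
-- gives j^m ≤ m! p^(m(m+1)/2) A_m(j); at j = p^(m+1) the left side is
-- p^(m(m+1)), so p^(m(m+1)/2) ≤ m! A_m(p^(m+1)) ≤ m^m p̃(p^(m+1)).
module Submission where

open import Defs
open import Data.Bool using (Bool; true; false; T; if_then_else_)
open import Data.Empty using (⊥-elim)
open import Data.Nat
  using (ℕ; zero; suc; _+_; _*_; _∸_; _^_; _≤_; _<_; _/_; _≤ᵇ_; _≤′_; ≤′-reflexive; ≤′-step; _≤?_; _!;
         z≤n; s≤s; NonZero; >-nonZero; nonTrivial⇒n>1)
open import Data.Nat.DivMod using (m*n/n≡m)
open import Data.Nat.Induction using (<-rec)
open import Data.Nat.Primality using (Prime; prime⇒nonTrivial)
open import Data.Nat.Properties
open import Data.Nat.Tactic.RingSolver using (solve-∀)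
open import Data.Product using (_×_; _,_)
open import Data.Unit using (tt)
open import Relation.Binary.PropositionalEquality using (_≡_; refl; sym; trans; cong; subst; subst₂)
open import Relation.Nullary using (yes; no)

suc-mono⇒mono : (f : ℕ → ℕ) → (∀ n → f n ≤ f (suc n)) → ∀ {m n} → m ≤ n → f m ≤ f n
suc-mono⇒mono f step m≤n = go (≤⇒≤′ m≤n)
  where
  go : ∀ {m n} → m ≤′ n → f m ≤ f n
  go (≤′-reflexive refl) = ≤-refl
  go (≤′-step m≤′n)      = ≤-trans (go m≤′n) (step _)

head≤sumUpTo : ∀ n (f : ℕ → ℕ) → f 0 ≤ sumUpTo n f
head≤sumUpTo zero    f = ≤-refl
head≤sumUpTo (suc n) f = ≤-trans (head≤sumUpTo n f) (m≤m+n _ _)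

sumUpTo-mono-≤ : ∀ n {f g : ℕ → ℕ} → (∀ k → f k ≤ g k) → sumUpTo n f ≤ sumUpTo n g
sumUpTo-mono-≤ zero    f≤g = f≤g 0
sumUpTo-mono-≤ (suc n) f≤g = +-mono-≤ (sumUpTo-mono-≤ n f≤g) (f≤g (suc n))

sumUpTo-monoˡ-≤ : ∀ (f : ℕ → ℕ) {m n} → m ≤ n → sumUpTo m f ≤ sumUpTo n f
sumUpTo-monoˡ-≤ f = suc-mono⇒mono (λ n → sumUpTo n f) (λ n → m≤m+n _ _)

sumUpTo-suc : ∀ n (f : ℕ → ℕ) → sumUpTo (suc n) f ≡ f 0 + sumUpTo n (λ k → f (suc k))
sumUpTo-suc zero    f = refl
sumUpTo-suc (suc n) f = trans (cong (_+ f (suc (suc n))) (sumUpTo-suc n f)) (+-assoc (f 0) _ _)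

if-then-0-mono-≤ : ∀ {b c : Bool} {x y : ℕ} → (T b → T c) → (T b → x ≤ y) →
                   (if b then x else 0) ≤ (if c then y else 0)
if-then-0-mono-≤ {false}          _   _   = z≤n
if-then-0-mono-≤ {true} {true}  _   x≤y = x≤y tt
if-then-0-mono-≤ {true} {false} b⇒c _   = ⊥-elim (b⇒c tt)

withPart : (ℕ → ℕ) → ℕ → ℕ → ℕ
withPart g q j = sumUpTo j (λ k → if k * q ≤ᵇ j then g (j ∸ k * q) else 0)

≤withPart : ∀ g q j → g j ≤ withPart g q j
≤withPart g q j = head≤sumUpTo j _

withPart-mono-≤ : ∀ {g} q → (∀ {i j} → i ≤ j → g i ≤ g j) →
                  ∀ {i j} → i ≤ j → withPart g q i ≤ withPart g q j
withPart-mono-≤ {g} q g-mono {i} {j} i≤j = ≤-trans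
  (sumUpTo-mono-≤ i (λ k → if-then-0-mono-≤
    (λ kq≤ᵇi → ≤⇒≤ᵇ (≤-trans (≤ᵇ⇒≤ (k * q) i kq≤ᵇi) i≤j))
    (λ _ → g-mono (∸-monoˡ-≤ (k * q) i≤j))))
  (sumUpTo-monoˡ-≤ _ i≤j)

-- The k-th term of the sum for j − q is the (k+1)-st term of the sum for j.
withPart-recurrence : ∀ g q j → 0 < q → q ≤ j → g j + withPart g q (j ∸ q) ≤ withPart g q j
withPart-recurrence g q zero    q>0 q≤0 = ⊥-elim (<⇒≱ q>0 q≤0)
withPart-recurrence g q (suc n) q>0 q≤j = subst (g (suc n) + withPart g q (suc n ∸ q) ≤_)
  (sym (sumUpTo-suc n _))
  (+-monoʳ-≤ (g (suc n)) (≤-trans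
    (sumUpTo-mono-≤ (suc n ∸ q) (λ k → if-then-0-mono-≤
      (λ kq≤ᵇj-q → ≤⇒≤ᵇ (shift k (≤ᵇ⇒≤ (k * q) (suc n ∸ q) kq≤ᵇj-q)))
      (λ _ → ≤-reflexive (cong g (∸-+-assoc (suc n) q (k * q))))))
    (sumUpTo-monoˡ-≤ _ (∸-monoʳ-≤ (suc n) q>0))))
  where
  shift : ∀ k → k * q ≤ suc n ∸ q → q + k * q ≤ suc n
  shift k kq≤j-q = subst (q + k * q ≤_) (m+[n∸m]≡n q≤j) (+-monoʳ-≤ q kq≤j-q)

partBounded-monoʳ-≤ : ∀ p m {i j} → i ≤ j → partBounded p m i ≤ partBounded p m j
partBounded-monoʳ-≤ p zero    _   = ≤-refl
partBounded-monoʳ-≤ p (suc m) i≤j = withPart-mono-≤ (p ^ suc m) (partBounded-monoʳ-≤ p m) i≤j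

partBounded-monoˡ-≤ : ∀ p j {m n} → m ≤ n → partBounded p m j ≤ partBounded p n j
partBounded-monoˡ-≤ p j = suc-mono⇒mono (λ m → partBounded p m j)
  (λ m → ≤withPart (partBounded p m) (p ^ suc m) j)

pTilde-mono-≤ : ∀ p {m n} → m ≤ n → pTilde p m ≤ pTilde p n
pTilde-mono-≤ p {m} {n} m≤n = ≤-trans (partBounded-monoˡ-≤ p m m≤n) (partBounded-monoʳ-≤ p n m≤n)

[y+d]^suc≤ : ∀ m y d → (y + d) ^ suc m ≤ y ^ suc m + suc m * d * (y + d) ^ m
[y+d]^suc≤ zero    y d = ≤-reflexive (base y d)
  where
  base : ∀ y d → (y + d) * 1 ≡ y * 1 + 1 * d * 1
  base = solve-∀
[y+d]^suc≤ (suc m) y d = begin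
    (y + d) * (y + d) ^ suc m
  ≤⟨ *-monoʳ-≤ (y + d) ([y+d]^suc≤ m y d) ⟩
    (y + d) * (y ^ suc m + suc m * d * (y + d) ^ m)
  ≡⟨ expand y d (y ^ suc m) ((y + d) ^ m) m ⟩
    y * y ^ suc m + d * y ^ suc m + suc m * d * (y + d) ^ suc m
  ≤⟨ +-monoˡ-≤ _ (+-monoʳ-≤ (y * y ^ suc m) (*-monoʳ-≤ d (^-monoˡ-≤ (suc m) (m≤m+n y d)))) ⟩
    y * y ^ suc m + d * (y + d) ^ suc m + suc m * d * (y + d) ^ suc m
  ≡⟨ collect y d (y ^ suc m) ((y + d) ^ suc m) m ⟩
    y * y ^ suc m + suc (suc m) * d * (y + d) ^ suc m ∎
  where
  open ≤-Reasoning
  expand : ∀ y d Y X k → (y + d) * (Y + (1 + k) * d * X) ≡ y * Y + d * Y + (1 + k) * d * ((y + d) * X)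
  expand = solve-∀
  collect : ∀ y d Y Z k → y * Y + d * Z + (1 + k) * d * Z ≡ y * Y + (2 + k) * d * Z
  collect = solve-∀

growth-step : ∀ {f g : ℕ → ℕ} m q C → 0 < q → (∀ j → f j ≤ g j) →
              (∀ j → q ≤ j → f j + g (j ∸ q) ≤ g j) →
              (∀ j → j ^ m ≤ C * f j) → ∀ j → j ^ suc m ≤ suc m * q * (C * g j)
growth-step {f} {g} m q C q>0 f≤g recurrence bound = <-rec _ step
  where
  K = suc m * q
  step : ∀ j → (∀ {i} → i < j → i ^ suc m ≤ K * (C * g i)) → j ^ suc m ≤ K * (C * g j)
  step j ih with q ≤? j
  ... | no q≰j = begin
      j * j ^ m      ≤⟨ *-monoˡ-≤ (j ^ m) (<⇒≤ (≰⇒> q≰j)) ⟩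
      q * j ^ m      ≤⟨ *-monoʳ-≤ q (≤-trans (bound j) (*-monoʳ-≤ C (f≤g j))) ⟩
      q * (C * g j)  ≤⟨ *-monoˡ-≤ (C * g j) (m≤n*m q (suc m)) ⟩
      K * (C * g j)  ∎
    where open ≤-Reasoning
  ... | yes q≤j = begin
      j ^ suc m                      ≡⟨ cong (_^ suc m) (sym y+q≡j) ⟩
      (y + q) ^ suc m                ≤⟨ [y+d]^suc≤ m y q ⟩
      y ^ suc m + K * (y + q) ^ m    ≡⟨ cong (λ x → y ^ suc m + K * x ^ m) y+q≡j ⟩
      y ^ suc m + K * j ^ m          ≤⟨ +-mono-≤ (ih (∸-monoʳ-< q>0 q≤j)) (*-monoʳ-≤ K (bound j)) ⟩
      K * (C * g y) + K * (C * f j)  ≡⟨ +-comm (K * (C * g y)) _ ⟩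
      K * (C * f j) + K * (C * g y)  ≡⟨ sym (*-distribˡ-+ K _ _) ⟩
      K * (C * f j + C * g y)        ≡⟨ cong (K *_) (sym (*-distribˡ-+ C _ _)) ⟩
      K * (C * (f j + g y))          ≤⟨ *-monoʳ-≤ K (*-monoʳ-≤ C (recurrence j q≤j)) ⟩
      K * (C * g j)                  ∎
    where
    open ≤-Reasoning
    y = j ∸ q
    y+q≡j : y + q ≡ j
    y+q≡j = m∸n+n≡m q≤j

triangle : ℕ → ℕ
triangle zero    = 0
triangle (suc m) = triangle m + suc m

triangle-double : ∀ m → triangle m + triangle m ≡ suc m * m
triangle-double zero    = refl
triangle-double (suc m) = trans (regroup (triangle m) m)
  (trans (cong (_+ 2 * suc m) (triangle-double m)) (combine m))
  where
  regroup : ∀ t m → (t + (1 + m)) + (t + (1 + m)) ≡ (t + t) + 2 * (1 + m)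
  regroup = solve-∀
  combine : ∀ m → (1 + m) * m + 2 * (1 + m) ≡ (2 + m) * (1 + m)
  combine = solve-∀

partBounded-lower-bound : ∀ p .{{_ : NonZero p}} m j →
                          j ^ m ≤ m ! * p ^ triangle m * partBounded p m j
partBounded-lower-bound p zero    j = ≤-refl
partBounded-lower-bound p (suc m) j = begin
    j ^ suc m
  ≤⟨ growth-step m q (m ! * p ^ triangle m) (m^n>0 p (suc m))
       (λ i → ≤withPart A q i) (λ i → withPart-recurrence A q i (m^n>0 p (suc m)))
       (partBounded-lower-bound p m) j ⟩
    suc m * q * (m ! * p ^ triangle m * partBounded p (suc m) j)
  ≡⟨ regroup m q (m !) (p ^ triangle m) (partBounded p (suc m) j) ⟩
    suc m * m ! * (p ^ triangle m * q) * partBounded p (suc m) j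
  ≡⟨ cong (λ x → suc m ! * x * partBounded p (suc m) j) (sym (^-distribˡ-+-* p (triangle m) (suc m))) ⟩
    suc m ! * p ^ triangle (suc m) * partBounded p (suc m) j ∎
  where
  open ≤-Reasoning
  q = p ^ suc m
  A = partBounded p m
  regroup : ∀ k q F P X → (1 + k) * q * (F * P * X) ≡ (1 + k) * F * (P * q) * X
  regroup = solve-∀

!≤^ : ∀ m → m ! ≤ m ^ m
!≤^ zero    = ≤-refl
!≤^ (suc m) = *-monoʳ-≤ (suc m) (≤-trans (!≤^ m) (^-monoˡ-≤ m (n≤1+n m)))

n<m^n : ∀ m → 1 < m → ∀ n → n < m ^ n
n<m^n m m>1 zero    = s≤s z≤n
n<m^n m m>1 (suc n) = begin-strict
    suc n               <⟨ +-mono-≤ (m^n>0 m n) (n<m^n m m>1 n) ⟩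
    m ^ n + m ^ n       ≡⟨ cong (m ^ n +_) (sym (+-identityʳ (m ^ n))) ⟩
    2 * m ^ n           ≤⟨ *-monoˡ-≤ (m ^ n) m>1 ⟩
    m * m ^ n           ∎
  where
  open ≤-Reasoning
  instance
    m≢0 : NonZero m
    m≢0 = >-nonZero (<⇒≤ m>1)

pTilde-lower-bound : ∀ p → 1 < p → ∀ m → p ^ triangle m ≤ m ^ m * pTilde p (p ^ suc m)
pTilde-lower-bound p p>1 m = begin
    P                               ≤⟨ *-cancelˡ-≤ P {{m^n≢0 p (triangle m)}} P²≤ ⟩
    m ! * A (p ^ suc m)             ≤⟨ *-monoˡ-≤ _ (!≤^ m) ⟩
    m ^ m * A (p ^ suc m)           ≤⟨ *-monoʳ-≤ (m ^ m) (partBounded-monoˡ-≤ p (p ^ suc m) m≤p^[1+m]) ⟩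
    m ^ m * pTilde p (p ^ suc m)    ∎
  where
  open ≤-Reasoning
  instance
    p≢0 : NonZero p
    p≢0 = >-nonZero (<⇒≤ p>1)
  P = p ^ triangle m
  A = partBounded p m
  p^[1+m]^m≡P*P : (p ^ suc m) ^ m ≡ P * P
  p^[1+m]^m≡P*P = trans (^-*-assoc p (suc m) m)
    (trans (cong (p ^_) (sym (triangle-double m))) (^-distribˡ-+-* p (triangle m) (triangle m)))
  P²≤ : P * P ≤ P * (m ! * A (p ^ suc m))
  P²≤ = subst₂ _≤_ p^[1+m]^m≡P*P (reorder (m !) P (A (p ^ suc m)))
    (partBounded-lower-bound p m (p ^ suc m))
    where
    reorder : ∀ F P X → F * P * X ≡ P * (F * X)
    reorder = solve-∀
  m≤p^[1+m] : m ≤ p ^ suc m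
  m≤p^[1+m] = <⇒≤ (<-trans (n<1+n m) (n<m^n p p>1 (suc m)))

triangle≡[1+m]*m/2 : ∀ m → (suc m * m) / 2 ≡ triangle m
triangle≡[1+m]*m/2 m = trans (cong (_/ 2) (trans (sym (triangle-double m)) (double≡*2 (triangle m))))
                             (m*n/n≡m (triangle m) 2)
  where
  double≡*2 : ∀ t → t + t ≡ t * 2
  double≡*2 = solve-∀

lemma3 : (p : ℕ) → Prime p →
    ((m n : ℕ) → m ≤ n → pTilde p m ≤ pTilde p n)
    × ((r : ℕ) → 2 ≤ r →
    p ^ ((r * (r ∸ 1)) / 2) ≤ (r ∸ 1) ^ (r ∸ 1) * pTilde p (p ^ r))
lemma3 p p-prime = (λ m n → pTilde-mono-≤ p) , bound
  where
  bound : (r : ℕ) → 2 ≤ r → p ^ ((r * (r ∸ 1)) / 2) ≤ (r ∸ 1) ^ (r ∸ 1) * pTilde p (p ^ r)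
  bound (suc m) _ = subst (_≤ m ^ m * pTilde p (p ^ suc m)) (cong (p ^_) (sym (triangle≡[1+m]*m/2 m)))
    (pTilde-lower-bound p (nonTrivial⇒n>1 p {{prime⇒nonTrivial p-prime}}) m)
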